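{- Let $\mathcal Q$ be a unital quantale with unit $\varepsilon$ and let $a\in\mathcal Q$ be strongly square increasing with $a\le\varepsilon$. Then $a$ is central, i.e. $a\cdot b=b\cdot a$ for all $b\in\mathcal Q$.
   Context: A quantale is a complete join-semilattice with an associative multiplication distributing over arbitrary joins on both sides; unital if it has a unit $\varepsilon$. An element $a$ is strongly square increasing if for all $b$, $a\cdot b\le a\cdot b\cdot a$ and $b\cdot a\le a\cdot b\cdot a$. -}

module Defs where

open import Data.Product using (_×_)
open import Level using (Level; suc; _⊔_)
open import Relation.Binary.PropositionalEquality using (_≡_)
open import Relation.Binary.Structures using (IsPartialOrder)

record UnitalQuantale (c ℓ : Level) : Set (suc (c ⊔ ℓ)) where
  infixl 7 _·_
  infix  4 _≤_
  field
    Carrier   : Set c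
    _≤_       : Carrier → Carrier → Set ℓ
    isPartialOrder : IsPartialOrder _≡_ _≤_
    ⋁         : {I : Set c} → (I → Carrier) → Carrier
    ⋁-upper   : {I : Set c} (f : I → Carrier) (i : I) → f i ≤ ⋁ f
    ⋁-least   : {I : Set c} (f : I → Carrier) (x : Carrier) →
                ((i : I) → f i ≤ x) → ⋁ f ≤ x
    _·_       : Carrier → Carrier → Carrier
    ε         : Carrier
    ·-assoc   : ∀ x y z → (x · y) · z ≡ x · (y · z)
    ·-identityˡ : ∀ x → ε · x ≡ x
    ·-identityʳ : ∀ x → x · ε ≡ x
    ·-distribˡ-⋁ : ∀ {I : Set c} (a : Carrier) (f : I → Carrier) →
                   a · ⋁ f ≡ ⋁ (λ i → a · f i)
    ·-distribʳ-⋁ : ∀ {I : Set c} (f : I → Carrier) (a : Carrier) →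
                   ⋁ f · a ≡ ⋁ (λ i → f i · a)

module _ {c ℓ : Level} (Q : UnitalQuantale c ℓ) where
  open UnitalQuantale Q

  StronglySquareIncreasing : Carrier → Set (c ⊔ ℓ)
  StronglySquareIncreasing a =
    ∀ b → (a · b ≤ a · b · a) × (b · a ≤ a · b · a)

  Central : Carrier → Set c
  Central a = ∀ b → a · b ≡ b · a

-- Since a ≤ ε, multiplying by a on either side can only decrease an element,
-- so a·b ≤ b and b·a ≤ b. Then a·b ≤ a·b·a ≤ b·a and b·a ≤ a·(b·a) ≤ a·b.
module Submission where

open import Level using (Level; Lift; lift)
open import Data.Bool using (Bool; true; false)
open import Data.Product using (proj₁; proj₂)
open import Relation.Binary.Bundles using (Poset)
open import Relation.Binary.PropositionalEquality using (_≡_; refl; sym; cong)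
open import Relation.Binary.Structures using (IsPartialOrder)
import Relation.Binary.Reasoning.PartialOrder as PosetReasoning
open import Defs

module UnitalQuantaleProperties {c ℓ : Level} (Q : UnitalQuantale c ℓ) where
  open UnitalQuantale Q
  open IsPartialOrder isPartialOrder using (antisym; reflexive)

  poset : Poset c c ℓ
  poset = record { isPartialOrder = isPartialOrder }

  open PosetReasoning poset

  infixr 6 _∨_

  pair : Carrier → Carrier → Lift c Bool → Carrier
  pair x y (lift true)  = x
  pair x y (lift false) = y

  _∨_ : Carrier → Carrier → Carrier
  x ∨ y = ⋁ (pair x y)

  x≤y⇒x∨y≡y : ∀ {x y} → x ≤ y → x ∨ y ≡ y
  x≤y⇒x∨y≡y {x} {y} x≤y =
    antisym (⋁-least (pair x y) y λ { (lift true) → x≤y ; (lift false) → reflexive refl })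
            (⋁-upper (pair x y) (lift false))

  -- Monotonicity comes from distributivity over the binary join x ∨ y = y.
  ·-monoʳ-≤ : ∀ z {x y} → x ≤ y → z · x ≤ z · y
  ·-monoʳ-≤ z {x} {y} x≤y = begin
    z · x                     ≤⟨ ⋁-upper (λ i → z · pair x y i) (lift true) ⟩
    ⋁ (λ i → z · pair x y i)  ≡⟨ sym (·-distribˡ-⋁ z (pair x y)) ⟩
    z · (x ∨ y)               ≡⟨ cong (z ·_) (x≤y⇒x∨y≡y x≤y) ⟩
    z · y                     ∎

  ·-monoˡ-≤ : ∀ z {x y} → x ≤ y → x · z ≤ y · z
  ·-monoˡ-≤ z {x} {y} x≤y = begin
    x · z                     ≤⟨ ⋁-upper (λ i → pair x y i · z) (lift true) ⟩
    ⋁ (λ i → pair x y i · z)  ≡⟨ sym (·-distribʳ-⋁ (pair x y) z) ⟩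
    (x ∨ y) · z               ≡⟨ cong (_· z) (x≤y⇒x∨y≡y x≤y) ⟩
    y · z                     ∎

  x≤ε⇒x·y≤y : ∀ {x} y → x ≤ ε → x · y ≤ y
  x≤ε⇒x·y≤y {x} y x≤ε = begin
    x · y   ≤⟨ ·-monoˡ-≤ y x≤ε ⟩
    ε · y   ≡⟨ ·-identityˡ y ⟩
    y       ∎

  x≤ε⇒y·x≤y : ∀ {x} y → x ≤ ε → y · x ≤ y
  x≤ε⇒y·x≤y {x} y x≤ε = begin
    y · x   ≤⟨ ·-monoʳ-≤ y x≤ε ⟩
    y · ε   ≡⟨ ·-identityʳ y ⟩
    y       ∎

  stronglySquareIncreasing∧≤ε⇒central :
    ∀ a → StronglySquareIncreasing Q a → a ≤ ε → Central Q a
  stronglySquareIncreasing∧≤ε⇒central a ssi a≤ε b = antisym ab≤ba ba≤ab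
    where
    ab≤ba : a · b ≤ b · a
    ab≤ba = begin
      a · b         ≤⟨ proj₁ (ssi b) ⟩
      a · b · a     ≤⟨ ·-monoˡ-≤ a (x≤ε⇒x·y≤y b a≤ε) ⟩
      b · a         ∎

    ba≤ab : b · a ≤ a · b
    ba≤ab = begin
      b · a         ≤⟨ proj₂ (ssi b) ⟩
      a · b · a     ≡⟨ ·-assoc a b a ⟩
      a · (b · a)   ≤⟨ ·-monoʳ-≤ a (x≤ε⇒y·x≤y b a≤ε) ⟩
      a · b         ∎

mainTheorem8 : {c ℓ : Level} (Q : UnitalQuantale c ℓ) (a : UnitalQuantale.Carrier Q) →
    StronglySquareIncreasing Q a → UnitalQuantale._≤_ Q a (UnitalQuantale.ε Q) →
    Central Q a
mainTheorem8 Q = UnitalQuantaleProperties.stronglySquareIncreasing∧≤ε⇒central Q
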